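{- Let $\mathcal{D}=(\mathcal{P},\mathcal{B},\mathcal{I})$ be a $G$-locally primitive $2$-design, $G\le\mathrm{Aut}(\mathcal{D})$, and assume $G$ is imprimitive on $\mathcal{B}$. Let $\Delta\subseteq\mathcal{B}$ be a block of imprimitivity for $G$ on $\mathcal{B}$ (so $1<|\Delta|<|\mathcal{B}|$ and for every $g\in G$ either $\Delta^g=\Delta$ or $\Delta^g\cap\Delta=\emptyset$). Then: (1) $G_{\alpha\beta}=G_{\alpha\Delta}$ for every point $\alpha$ and every $\beta\in\Delta$ incident with $\alpha$; (2) any two distinct $\beta_1,\beta_2\in\Delta$ satisfy $\mathcal{D}(\beta_1)\cap\mathcal{D}(\beta_2)=\emptyset$.
   Context: A $2$-design has a finite point set ($\ge2$ points), finite block set, each block incident with $k$ points, any two distinct points incident with exactly $\lambda\ge1$ blocks. $\mathcal{D}(\alpha)$ = blocks incident with point $\alpha$; $\mathcal{D}(\beta)$ = points incident with block $\beta$. $G$-locally primitive: $G_\alpha$ primitive on $\mathcal{D}(\alpha)$ for each point, $G_\beta$ primitive on $\mathcal{D}(\beta)$ for each block. $G_{\alpha\Delta}$ is the subgroup of $G_\alpha$ stabilizing the set $\Delta$, and $G_{\alpha\beta}=G_\alpha\cap G_\beta$. -}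

module Defs where

open import Data.Nat using (ℕ; _≤_; _<_)
open import Data.Bool using (Bool)
open import Data.Fin using (Fin)
open import Data.Fin.Subset using (Subset; _∈_; _∉_; _⊆_; _∩_; ∣_∣)
open import Data.Vec using (tabulate)
open import Data.Product using (_×_; ∃)
open import Data.Sum using (_⊎_)
open import Relation.Binary.PropositionalEquality using (_≡_; _≢_; refl; cong; trans; sym)
open import Function.Bundles using (_⇔_)

ptsOf : ∀ {v b} → (Fin v → Fin b → Bool) → Fin b → Subset v
ptsOf I β = tabulate (λ α → I α β)

blksOf : ∀ {v b} → (Fin v → Fin b → Bool) → Fin v → Subset b
blksOf I α = tabulate (λ β → I α β)

record Is2Design {v b : ℕ} (I : Fin v → Fin b → Bool) : Set where
  field
    k λ′       : ℕ
    two≤v      : 2 ≤ v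
    one≤λ      : 1 ≤ λ′
    blockSize  : ∀ β → ∣ ptsOf I β ∣ ≡ k
    pairCount  : ∀ α₁ α₂ → α₁ ≢ α₂ → ∣ blksOf I α₁ ∩ blksOf I α₂ ∣ ≡ λ′

record Aut {v b : ℕ} (I : Fin v → Fin b → Bool) : Set where
  field
    pf pf⁻¹ : Fin v → Fin v
    bf bf⁻¹ : Fin b → Fin b
    pf-invˡ : ∀ x → pf⁻¹ (pf x) ≡ x
    pf-invʳ : ∀ x → pf (pf⁻¹ x) ≡ x
    bf-invˡ : ∀ x → bf⁻¹ (bf x) ≡ x
    bf-invʳ : ∀ x → bf (bf⁻¹ x) ≡ x
    pres    : ∀ α β → I (pf α) (bf β) ≡ I α β

open Aut public

module _ {v b : ℕ} {I : Fin v → Fin b → Bool} where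

  idAut : Aut I
  idAut = record
    { pf = λ x → x ; pf⁻¹ = λ x → x ; bf = λ x → x ; bf⁻¹ = λ x → x
    ; pf-invˡ = λ _ → refl ; pf-invʳ = λ _ → refl
    ; bf-invˡ = λ _ → refl ; bf-invʳ = λ _ → refl
    ; pres = λ _ _ → refl }

  -- g ⋆ h : first apply g, then h  (right actions, α^{gh} = (α^g)^h)
  _⋆_ : Aut I → Aut I → Aut I
  g ⋆ h = record
    { pf = λ x → pf h (pf g x) ; pf⁻¹ = λ x → pf⁻¹ g (pf⁻¹ h x)
    ; bf = λ x → bf h (bf g x) ; bf⁻¹ = λ x → bf⁻¹ g (bf⁻¹ h x)
    ; pf-invˡ = λ x → trans (cong (pf⁻¹ g) (pf-invˡ h (pf g x))) (pf-invˡ g x)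
    ; pf-invʳ = λ x → trans (cong (pf h) (pf-invʳ g (pf⁻¹ h x))) (pf-invʳ h x)
    ; bf-invˡ = λ x → trans (cong (bf⁻¹ g) (bf-invˡ h (bf g x))) (bf-invˡ g x)
    ; bf-invʳ = λ x → trans (cong (bf h) (bf-invʳ g (bf⁻¹ h x))) (bf-invʳ h x)
    ; pres = λ α β → trans (pres h (pf g α) (bf g β)) (pres g α β) }

  invAut : Aut I → Aut I
  invAut g = record
    { pf = pf⁻¹ g ; pf⁻¹ = pf g ; bf = bf⁻¹ g ; bf⁻¹ = bf g
    ; pf-invˡ = pf-invʳ g ; pf-invʳ = pf-invˡ g
    ; bf-invˡ = bf-invʳ g ; bf-invʳ = bf-invˡ g
    ; pres = λ α β → sym (trans (cong₂′ (sym (pf-invʳ g α)) (sym (bf-invʳ g β)))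
                               (pres g (pf⁻¹ g α) (bf⁻¹ g β))) }
    where
      cong₂′ : ∀ {a a′ c c′} → a ≡ a′ → c ≡ c′ → I a c ≡ I a′ c′
      cong₂′ refl refl = refl

  record IsSubgroup (G : Aut I → Set) : Set where
    field
      id∈  : G idAut
      ⋆∈   : ∀ g h → G g → G h → G (g ⋆ h)
      inv∈ : ∀ g → G g → G (invAut g)
      resp : ∀ g h → G g → (∀ α → pf g α ≡ pf h α) → (∀ β → bf g β ≡ bf h β) → G h

module _ {v b m : ℕ} {I : Fin v → Fin b → Bool} where

  SetStabilises : (Aut I → Fin m → Fin m) → Subset m → Aut I → Set
  SetStabilises act Σ h = ∀ x → (x ∈ Σ) ⇔ (act h x ∈ Σ)

  IsBlockFor : (Aut I → Set) → (Aut I → Fin m → Fin m) → Subset m → Set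
  IsBlockFor H act Σ = ∀ h → H h →
    SetStabilises act Σ h ⊎ (∀ x → x ∈ Σ → act h x ∉ Σ)

  TransitiveOn : (Aut I → Set) → (Aut I → Fin m → Fin m) → Subset m → Set
  TransitiveOn H act X = ∀ x y → x ∈ X → y ∈ X → ∃ λ h → H h × act h x ≡ y

  PrimitiveOn : (Aut I → Set) → (Aut I → Fin m → Fin m) → Subset m → Set
  PrimitiveOn H act X = TransitiveOn H act X ×
    (∀ Σ → Σ ⊆ X → IsBlockFor H act Σ → ∣ Σ ∣ ≤ 1 ⊎ ∣ Σ ∣ ≡ ∣ X ∣)

module _ {v b : ℕ} {I : Fin v → Fin b → Bool} where

  pointStab : (Aut I → Set) → Fin v → Aut I → Set
  pointStab G α g = G g × pf g α ≡ α

  blockStab : (Aut I → Set) → Fin b → Aut I → Set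
  blockStab G β g = G g × bf g β ≡ β

  flagStab : (Aut I → Set) → Fin v → Fin b → Aut I → Set
  flagStab G α β g = G g × pf g α ≡ α × bf g β ≡ β

  pointSetStab : (Aut I → Set) → Fin v → Subset b → Aut I → Set
  pointSetStab G α Δ g = G g × pf g α ≡ α × SetStabilises bf Δ g

  LocallyPrimitive : (Aut I → Set) → Set
  LocallyPrimitive G =
    (∀ α → PrimitiveOn (pointStab G α) bf (blksOf I α)) ×
    (∀ β → PrimitiveOn (blockStab G β) pf (ptsOf I β))

  IsImprimitivityBlock : (Aut I → Set) → Subset b → Set
  IsImprimitivityBlock G Δ = 1 < ∣ Δ ∣ × ∣ Δ ∣ < b × IsBlockFor G bf Δ

  ImprimitiveOnBlocks : (Aut I → Set) → Set
  ImprimitiveOnBlocks G =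
    (∀ β γ → ∃ λ g → G g × bf g β ≡ γ) × ∃ λ Δ → IsImprimitivityBlock G Δ

{-# OPTIONS --safe #-}
-- Fix a point α. Since G_α preserves both Δ and D(α), the set Δ ∩ D(α) is a
-- block for G_α inside D(α), so by primitivity it has at most one element or is
-- all of D(α). In the second case D(α) ⊆ Δ spreads to every point: any other
-- point δ shares a block β ∈ Δ with α, and G_β (which fixes β, hence stabilises
-- Δ) moves α to δ. As every block has a point, Δ would be the whole block set.
-- So |Δ ∩ D(α)| ≤ 1, which is (2), and it forces an element of G_α stabilising Δ
-- to fix the unique block of Δ through α, which is (1).
module Submission where

open import Defs
open import Data.Nat using (ℕ; _≤_; _<_; s≤s)
open import Data.Nat.Properties using (≤-trans; <-irrefl; <⇒≱)
open import Data.Bool using (Bool; T)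
open import Data.Bool.Properties using (T-≡)
open import Data.Fin using (Fin; _≟_)
import Data.Fin as Fin
open import Data.Fin.Subset using (Subset; _∈_; _⊆_; _∩_; ∣_∣; ⊤; Nonempty)
open import Data.Fin.Subset.Properties
  using (p⊆q⇒∣p∣≤∣q∣; ∣⁅x⁆∣≡1; x∈⁅y⁆⇒x≡y; x∈p⇒∣p-x∣<∣p∣; x∈p∧x≢y⇒x∈p-y;
         nonempty?; Empty-unique; ∣⊥∣≡0; ∣⊤∣≡n; x∈p∩q⁺; x∈p∩q⁻; _∈?_; p⊂q⇒∣p∣<∣q∣)
open import Data.Vec using (tabulate)
open import Data.Vec.Properties using ([]=⇒lookup; lookup⇒[]=; lookup∘tabulate)
open import Data.Product using (_×_; _,_; proj₁; proj₂; ∃)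
open import Data.Sum using (_⊎_; inj₁; inj₂)
open import Relation.Binary.PropositionalEquality
  using (_≡_; _≢_; refl; sym; trans; cong; cong₂; subst)
open import Relation.Nullary using (¬_; yes; no; contradiction)
open import Function.Bundles using (_⇔_; mk⇔; Equivalence)

private
  variable
    n : ℕ
    p q : Subset n
    x y : Fin n

∈-tabulate : (f : Fin n → Bool) → x ∈ tabulate f ⇔ T (f x)
∈-tabulate {x = x} f = mk⇔
  (λ x∈ → Equivalence.from T-≡ (trans (sym (lookup∘tabulate f x)) ([]=⇒lookup x∈)))
  (λ fx → lookup⇒[]= x (tabulate f) (trans (lookup∘tabulate f x) (Equivalence.to T-≡ fx)))

x∈p⇒0<∣p∣ : x ∈ p → 0 < ∣ p ∣
x∈p⇒0<∣p∣ {x = x} {p = p} x∈p = subst (_≤ ∣ p ∣) (∣⁅x⁆∣≡1 x)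
  (p⊆q⇒∣p∣≤∣q∣ (λ y∈⁅x⁆ → subst (_∈ p) (sym (x∈⁅y⁆⇒x≡y x y∈⁅x⁆)) x∈p))

0<∣p∣⇒Nonempty : 0 < ∣ p ∣ → Nonempty p
0<∣p∣⇒Nonempty {n} {p} 0<∣p∣ with nonempty? p
... | yes ne = ne
... | no ¬ne = contradiction (subst (λ r → 0 < ∣ r ∣) (Empty-unique ¬ne) 0<∣p∣)
                             (λ 0<∣⊥∣ → <-irrefl (sym (∣⊥∣≡0 n)) 0<∣⊥∣)

∣p∣≤1⇒x≡y : ∣ p ∣ ≤ 1 → x ∈ p → y ∈ p → x ≡ y
∣p∣≤1⇒x≡y {x = x} {y = y} ∣p∣≤1 x∈p y∈p with x ≟ y
... | yes x≡y = x≡y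
... | no  x≢y = contradiction ∣p∣≤1 (<⇒≱ (≤-trans (s≤s 0<∣p-x∣) (x∈p⇒∣p-x∣<∣p∣ x∈p)))
  where 0<∣p-x∣ = x∈p⇒0<∣p∣ (x∈p∧x≢y⇒x∈p-y y∈p (λ y≡x → x≢y (sym y≡x)))

p⊆q∧∣p∣≡∣q∣⇒q⊆p : p ⊆ q → ∣ p ∣ ≡ ∣ q ∣ → q ⊆ p
p⊆q∧∣p∣≡∣q∣⇒q⊆p {p = p} p⊆q ∣p∣≡∣q∣ {x} x∈q with x ∈? p
... | yes x∈p = x∈p
... | no  x∉p = contradiction ∣p∣≡∣q∣ (λ eq → <-irrefl eq (p⊂q⇒∣p∣<∣q∣ (p⊆q , x , x∈q , x∉p)))

module _ {v b m : ℕ} {I : Fin v → Fin b → Bool}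
         {H : Aut I → Set} {act : Aut I → Fin m → Fin m} where

  IsBlockFor-fixes⇒stabilises : ∀ {Σ h x} → IsBlockFor H act Σ → H h →
    x ∈ Σ → act h x ≡ x → SetStabilises act Σ h
  IsBlockFor-fixes⇒stabilises {x = x} block Hh x∈Σ hx≡x with block _ Hh
  ... | inj₁ stabilises = stabilises
  ... | inj₂ disjoint   = contradiction (subst (_∈ _) (sym hx≡x) x∈Σ) (disjoint x x∈Σ)

  IsBlockFor-∩-invariant : ∀ {Σ X} → IsBlockFor H act Σ →
    (∀ h → H h → SetStabilises act X h) → IsBlockFor H act (Σ ∩ X)
  IsBlockFor-∩-invariant {Σ} {X} block invariant h Hh with block h Hh
  ... | inj₁ stabilises = inj₁ λ x → mk⇔
    (λ x∈Σ∩X → let x∈Σ , x∈X = x∈p∩q⁻ Σ X x∈Σ∩X in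
       x∈p∩q⁺ (Equivalence.to (stabilises x) x∈Σ , Equivalence.to (invariant h Hh x) x∈X))
    (λ hx∈Σ∩X → let hx∈Σ , hx∈X = x∈p∩q⁻ Σ X hx∈Σ∩X in
       x∈p∩q⁺ (Equivalence.from (stabilises x) hx∈Σ , Equivalence.from (invariant h Hh x) hx∈X))
  ... | inj₂ disjoint = inj₂ λ x x∈Σ∩X hx∈Σ∩X →
    disjoint x (proj₁ (x∈p∩q⁻ Σ X x∈Σ∩X)) (proj₁ (x∈p∩q⁻ Σ X hx∈Σ∩X))

  PrimitiveOn-block : ∀ {X Σ} → PrimitiveOn H act X → Σ ⊆ X →
    IsBlockFor H act Σ → ∣ Σ ∣ ≤ 1 ⊎ X ⊆ Σ
  PrimitiveOn-block (_ , trivialBlocks) Σ⊆X block with trivialBlocks _ Σ⊆X block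
  ... | inj₁ ∣Σ∣≤1   = inj₁ ∣Σ∣≤1
  ... | inj₂ ∣Σ∣≡∣X∣ = inj₂ (p⊆q∧∣p∣≡∣q∣⇒q⊆p Σ⊆X ∣Σ∣≡∣X∣)

∈ptsOf : ∀ {v b} (I : Fin v → Fin b → Bool) {α β} → α ∈ ptsOf I β ⇔ T (I α β)
∈ptsOf I {β = β} = ∈-tabulate (λ α → I α β)

∈blksOf : ∀ {v b} (I : Fin v → Fin b → Bool) {α β} → β ∈ blksOf I α ⇔ T (I α β)
∈blksOf I {α = α} = ∈-tabulate (I α)

module _ {v b : ℕ} {I : Fin v → Fin b → Bool} where

  incidence-transport : (h : Aut I) → ∀ {α δ γ} → pf h α ≡ δ →
    I δ γ ≡ I α (bf⁻¹ h γ)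
  incidence-transport h {α} {δ} {γ} hα≡δ =
    trans (cong₂ I (sym hα≡δ) (sym (bf-invʳ h γ))) (pres h α (bf⁻¹ h γ))

  fixes⇒incidence : (h : Aut I) → ∀ {α β} → pf h α ≡ α → I α (bf h β) ≡ I α β
  fixes⇒incidence h {α} {β} hα≡α = trans (cong (λ a → I a (bf h β)) (sym hα≡α)) (pres h α β)

  pointStab-stabilises-blksOf : ∀ {G α} h → pointStab G α h → SetStabilises bf (blksOf I α) h
  pointStab-stabilises-blksOf h (_ , hα≡α) β = mk⇔
    (λ β∈ → Equivalence.from (∈blksOf I)
      (subst T (sym (fixes⇒incidence h hα≡α)) (Equivalence.to (∈blksOf I) β∈)))
    (λ hβ∈ → Equivalence.from (∈blksOf I)
      (subst T (fixes⇒incidence h hα≡α) (Equivalence.to (∈blksOf I) hβ∈)))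

  module _ (D : Is2Design I) where
    open Is2Design D

    commonBlock : ∀ {α δ} → α ≢ δ → ∃ λ β → T (I α β) × T (I δ β)
    commonBlock {α} {δ} α≢δ with 0<∣p∣⇒Nonempty (subst (0 <_) (sym (pairCount α δ α≢δ)) one≤λ)
    ... | β , β∈ = let β∈α , β∈δ = x∈p∩q⁻ _ _ β∈ in
      β , Equivalence.to (∈blksOf I) β∈α , Equivalence.to (∈blksOf I) β∈δ

    0<k : 0 < k
    0<k with two≤v
    ... | s≤s (s≤s _) with commonBlock {α = Fin.zero} {δ = Fin.suc Fin.zero} (λ ())
    ...   | β , incident , _ =
      subst (0 <_) (blockSize β) (x∈p⇒0<∣p∣ (Equivalence.from (∈ptsOf I) incident))

    incidentPoint : ∀ β → ∃ λ α → T (I α β)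
    incidentPoint β with 0<∣p∣⇒Nonempty (subst (0 <_) (sym (blockSize β)) 0<k)
    ... | α , α∈ = α , Equivalence.to (∈ptsOf I) α∈

  module _ (G : Aut I → Set) {Δ : Subset b} (block : IsBlockFor G bf Δ) where

    blksOf⊆-transport : ∀ {h α δ} → SetStabilises bf Δ h → pf h α ≡ δ →
      blksOf I α ⊆ Δ → blksOf I δ ⊆ Δ
    blksOf⊆-transport {h} stabilises hα≡δ Dα⊆Δ {γ} γ∈Dδ =
      subst (_∈ Δ) (bf-invʳ h γ) (Equivalence.to (stabilises (bf⁻¹ h γ))
        (Dα⊆Δ (Equivalence.from (∈blksOf I)
          (subst T (incidence-transport h hα≡δ) (Equivalence.to (∈blksOf I) γ∈Dδ)))))

    blksOf⊆-spreads : (∀ β → TransitiveOn (blockStab G β) pf (ptsOf I β)) →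
      ∀ {α δ β} → T (I α β) → T (I δ β) → blksOf I α ⊆ Δ → blksOf I δ ⊆ Δ
    blksOf⊆-spreads transitive {α} {δ} {β} αβ δβ Dα⊆Δ
      with transitive β α δ (Equivalence.from (∈ptsOf I) αβ) (Equivalence.from (∈ptsOf I) δβ)
    ... | h , (Gh , hβ≡β) , hα≡δ =
      blksOf⊆-transport {h = h} (IsBlockFor-fixes⇒stabilises block Gh β∈Δ hβ≡β) hα≡δ Dα⊆Δ
      where β∈Δ = Dα⊆Δ (Equivalence.from (∈blksOf I) αβ)

module _ {v b : ℕ} {I : Fin v → Fin b → Bool} (D : Is2Design I)
         {G : Aut I → Set} (lp : LocallyPrimitive G)
         {Δ : Subset b} (block : IsBlockFor G bf Δ) where

  blksOf⊆Δ⇒⊤⊆Δ : ∀ {α} → blksOf I α ⊆ Δ → ⊤ ⊆ Δ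
  blksOf⊆Δ⇒⊤⊆Δ {α} Dα⊆Δ {γ} _ with incidentPoint D γ
  ... | δ , δγ with α ≟ δ
  ...   | yes refl = Dα⊆Δ (Equivalence.from (∈blksOf I) δγ)
  ...   | no  α≢δ with commonBlock D α≢δ
  ...     | β , αβ , δβ = blksOf⊆-spreads G block (λ β → proj₁ (proj₂ lp β)) αβ δβ Dα⊆Δ
                            (Equivalence.from (∈blksOf I) δγ)

  ∣Δ∩blksOf∣≤1 : ∣ Δ ∣ < b → ∀ α → ∣ Δ ∩ blksOf I α ∣ ≤ 1
  ∣Δ∩blksOf∣≤1 ∣Δ∣<b α
    with PrimitiveOn-block (proj₁ lp α) (λ {β} β∈ → proj₂ (x∈p∩q⁻ Δ _ β∈))
           (IsBlockFor-∩-invariant (λ h (Gh , _) → block h Gh) pointStab-stabilises-blksOf)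
  ... | inj₁ ∣Δ∩Dα∣≤1 = ∣Δ∩Dα∣≤1
  ... | inj₂ Dα⊆Δ∩Dα  = contradiction (subst (_≤ ∣ Δ ∣) (∣⊤∣≡n b)
          (p⊆q⇒∣p∣≤∣q∣ (blksOf⊆Δ⇒⊤⊆Δ (λ β∈ → proj₁ (x∈p∩q⁻ Δ _ (Dα⊆Δ∩Dα β∈))))))
          (<⇒≱ ∣Δ∣<b)

lemma5p2 : {v b : ℕ} (I : Fin v → Fin b → Bool) → Is2Design I →
    (G : Aut I → Set) → IsSubgroup G → LocallyPrimitive G →
    ImprimitiveOnBlocks G →
    (Δ : Subset b) → IsImprimitivityBlock G Δ →
    ((α : Fin v) (β : Fin b) → β ∈ Δ → T (I α β) →
       (g : Aut I) → flagStab G α β g ⇔ pointSetStab G α Δ g)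
    ×
    ((β₁ β₂ : Fin b) → β₁ ∈ Δ → β₂ ∈ Δ → β₁ ≢ β₂ →
       (α : Fin v) → ¬ (T (I α β₁) × T (I α β₂)))
lemma5p2 I D G _ lp _ Δ (_ , ∣Δ∣<b , block) = flagStab⇔pointSetStab , disjoint
  where
    unique : ∀ {α β₁ β₂} → β₁ ∈ Δ → β₂ ∈ Δ → T (I α β₁) → T (I α β₂) → β₁ ≡ β₂
    unique {α} β₁∈Δ β₂∈Δ αβ₁ αβ₂ = ∣p∣≤1⇒x≡y (∣Δ∩blksOf∣≤1 D lp block ∣Δ∣<b α)
      (x∈p∩q⁺ (β₁∈Δ , Equivalence.from (∈blksOf I) αβ₁))
      (x∈p∩q⁺ (β₂∈Δ , Equivalence.from (∈blksOf I) αβ₂))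

    flagStab⇔pointSetStab : ∀ α β → β ∈ Δ → T (I α β) → ∀ g →
      flagStab G α β g ⇔ pointSetStab G α Δ g
    flagStab⇔pointSetStab α β β∈Δ αβ g = mk⇔
      (λ (Gg , gα≡α , gβ≡β) → Gg , gα≡α , IsBlockFor-fixes⇒stabilises block Gg β∈Δ gβ≡β)
      (λ (Gg , gα≡α , stabilises) → Gg , gα≡α ,
         unique (Equivalence.to (stabilises β) β∈Δ) β∈Δ
                (subst T (sym (fixes⇒incidence g gα≡α)) αβ) αβ)

    disjoint : ∀ β₁ β₂ → β₁ ∈ Δ → β₂ ∈ Δ → β₁ ≢ β₂ → ∀ α → ¬ (T (I α β₁) × T (I α β₂))
    disjoint _ _ β₁∈Δ β₂∈Δ β₁≢β₂ _ (αβ₁ , αβ₂) = β₁≢β₂ (unique β₁∈Δ β₂∈Δ αβ₁ αβ₂)
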